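{- If a spider $S = S(\lambda_1, \ldots, \lambda_d)$ has a connected partition of every type (i.e. of type $\mu$ for every partition $\mu$ of its number of vertices), then the line graph $S_L$ of $S$ also has a connected partition of every type (i.e. of type $\mu$ for every partition $\mu$ of the number of vertices of $S_L$).
   Context: For positive integers $\lambda_1,\ldots,\lambda_d$, the spider $S(\lambda_1,\ldots,\lambda_d)$ is the tree consisting of a center vertex $v$ together with $d$ paths ("legs") having $\lambda_1,\ldots,\lambda_d$ vertices respectively, each attached to $v$ by an edge at one of its endpoints. A connected partition of an $n$-vertex graph is a partition of its vertex set into sets each inducing a connected subgraph; its type is the integer partition of $n$ formed by the sizes of the sets. The line graph $S_L$ has the edges of $S$ as vertices, two being adjacent when they share an endpoint. -}

module Defs where

open import Data.Nat using (ℕ; zero; suc; _+_; _≡ᵇ_; _<ᵇ_; _≥_; NonZero)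
open import Data.Bool using (Bool; true; false; _∧_; _∨_; not; if_then_else_)
open import Data.Fin using (Fin; toℕ) renaming (_≟_ to _≟ᶠ_)
open import Data.List using (List; []; _∷_; _++_; length; filter; lookup; concatMap; allFin)
open import Data.Nat.ListAction using (sum)
open import Data.Bool.ListAction using (any)
open import Data.List.Relation.Unary.All using (All)
open import Data.List.Relation.Unary.Linked using (Linked)
open import Data.Product using (Σ; _×_; _,_; proj₁; proj₂)
open import Relation.Binary.PropositionalEquality using (_≡_)

record Graph : Set where
  field
    n   : ℕ
    adj : Fin n → Fin n → Bool
open Graph public

IsPartition : ℕ → List ℕ → Set
IsPartition m μ = All NonZero μ × Linked _≥_ μ × sum μ ≡ m

data WalkIn (G : Graph) (S : Fin (n G) → Set) : Fin (n G) → Fin (n G) → Set where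
  here : ∀ {u} → WalkIn G S u u
  step : ∀ {u w v} → adj G u w ≡ true → S w → WalkIn G S w v → WalkIn G S u v

InducesConnected : (G : Graph) → (Fin (n G) → Set) → Set
InducesConnected G S = ∀ u v → S u → S v → WalkIn G S u v

-- The blocks are indexed by
-- Fin (length μ); block i is the fibre of f over i, it has exactly
-- (lookup μ i) vertices (hence is nonempty, as μ has positive parts)
-- and induces a connected subgraph.

blockSize : (G : Graph) {k : ℕ} → (Fin (n G) → Fin k) → Fin k → ℕ
blockSize G f i = length (filter (λ v → f v ≟ᶠ i) (allFin (n G)))

HasConnectedPartitionOfType : Graph → List ℕ → Set
HasConnectedPartitionOfType G μ =
  Σ (Fin (n G) → Fin (length μ)) λ f →
    ∀ i → blockSize G f i ≡ lookup μ i × InducesConnected G (λ v → f v ≡ i)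

HasConnectedPartitionOfEveryType : Graph → Set
HasConnectedPartitionOfEveryType G =
  ∀ μ → IsPartition (n G) μ → HasConnectedPartitionOfType G μ

-- Line graph: vertices are the edges {i,j} (i < j, adjacent) of G,
-- listed in a fixed order; two are adjacent iff distinct and sharing
-- an endpoint.

edgesOf : (G : Graph) → List (Fin (n G) × Fin (n G))
edgesOf G = concatMap (λ i → concatMap (λ j →
              if (toℕ i <ᵇ toℕ j) ∧ adj G i j then (i , j) ∷ [] else [])
              (allFin (n G))) (allFin (n G))

_==ᶠ_ : ∀ {m} → Fin m → Fin m → Bool
a ==ᶠ b = toℕ a ≡ᵇ toℕ b

lineGraph : Graph → Graph
lineGraph G = record
  { n   = length (edgesOf G)
  ; adj = λ e f →
      let a = proj₁ (lookup (edgesOf G) e) ; b = proj₂ (lookup (edgesOf G) e)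
          c = proj₁ (lookup (edgesOf G) f) ; d = proj₂ (lookup (edgesOf G) f)
      in not (e ==ᶠ f) ∧ ((a ==ᶠ c) ∨ (a ==ᶠ d) ∨ (b ==ᶠ c) ∨ (b ==ᶠ d))
  }

-- Vertex 0 is the center; leg number t occupies
-- the vertices s+1, …, s+λ_t where s = λ₁ + … + λ_{t-1}; its vertex
-- s+1 is joined to the center and consecutive vertices are joined.

pathEdges : ℕ → ℕ → List (ℕ × ℕ)
pathEdges a zero    = []
pathEdges a (suc l) = (a , suc a) ∷ pathEdges (suc a) l

legEdges : ℕ → ℕ → List (ℕ × ℕ)
legEdges s zero    = []
legEdges s (suc l) = (0 , suc s) ∷ pathEdges (suc s) l

spiderEdgesFrom : ℕ → List ℕ → List (ℕ × ℕ)
spiderEdgesFrom s []       = []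
spiderEdgesFrom s (l ∷ ls) = legEdges s l ++ spiderEdgesFrom (s + l) ls

spider : List ℕ → Graph
spider λs = record
  { n   = suc (sum λs)
  ; adj = λ u v → any (λ e → ((toℕ u ≡ᵇ proj₁ e) ∧ (toℕ v ≡ᵇ proj₂ e))
                           ∨ ((toℕ v ≡ᵇ proj₁ e) ∧ (toℕ u ≡ᵇ proj₂ e)))
                      (spiderEdgesFrom 0 λs)
  }

-- Given a partition μ of the N edges of the spider S, the list μ ∷ʳ 1 is a partition of its
-- N + 1 vertices, so S has a connected partition of that type; let x be the vertex forming the
-- singleton block. Rooting the tree S at x and sending every other vertex to the edge joining it
-- to its parent is a bijection from V(S) ∖ {x} onto V(S_L) under which adjacent vertices go to
-- edges sharing an endpoint. So the remaining blocks, connected in S − x, are carried to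
-- connected sets of S_L of the same sizes.

module Submission where

open import Defs
open import Data.Nat
  using (ℕ; NonZero; zero; suc; pred; _+_; _<ᵇ_; _≡ᵇ_; _≤_; _<_; _≥_; z≤n; s≤s; s≤s⁻¹)
import Data.Nat.Properties as ℕ
open import Data.Nat.Properties using (<ᵇ⇒<; <⇒<ᵇ; ≡⇒≡ᵇ; ≡ᵇ⇒≡)
open import Data.Nat.ListAction using (sum)
open import Data.Nat.ListAction.Properties using (sum-++)
open import Data.Bool using (true; false; T; _∧_; _∨_; if_then_else_)
open import Data.Bool.Properties using (T-≡; T-∧; T-∨; T-not-≡)
open import Data.List using (List; []; _∷_; _∷ʳ_; length; filter; lookup; allFin; tabulate; concatMap)
open import Data.List.Membership.Propositional using (_∈_; lose; find)
open import Data.List.Relation.Unary.Any.Properties using (any⁺; any⁻; lookup-index)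
open import Data.List.Membership.Propositional.Properties
  using (∈-filter⁺; ∈-filter⁻; ∈-allFin; ∈-++⁻; ∈-++⁺ˡ; ∈-++⁺ʳ; ∈-concatMap⁺; ∈-concatMap⁻; ∈-lookup)
open import Data.List.Relation.Unary.Any using (here; there; satisfied; index)
open import Data.List.Relation.Unary.All as All using (All; []; _∷_)
import Data.List.Relation.Unary.All.Properties as All
open import Data.List.Relation.Unary.AllPairs as AllPairs using ([]; _∷_)
import Data.List.Relation.Unary.AllPairs.Properties as AllPairs
open import Data.List.Relation.Unary.Unique.Propositional using (Unique)
open import Data.List.Relation.Unary.Unique.Propositional.Properties using (concat⁺; allFin⁺)
open import Data.List.Relation.Binary.Disjoint.Propositional using (Disjoint)
open import Data.List.Relation.Unary.Linked using (Linked; []; [-]; _∷_)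
open import Data.Fin using (Fin; zero; suc; toℕ; fromℕ<; punchIn; punchOut) renaming (_≟_ to _≟ᶠ_)
open import Data.Fin.Properties
  using (suc-injective; toℕ-injective; toℕ-fromℕ<; toℕ<n; punchInᵢ≢i; punchIn-injective;
         punchIn-punchOut; punchOut-punchIn; punchOut-cong)
open import Data.Fin.Permutation
  using (Permutation; permutation; _⟨$⟩ʳ_; _⟨$⟩ˡ_; inverseˡ; inverseʳ; ↔⇒≡)
open import Data.Product using (Σ; _×_; _,_; proj₁; proj₂; uncurry)
open import Data.Sum using (_⊎_; inj₁; inj₂; map₂)
open import Data.Empty using (⊥; ⊥-elim)
open import Function using (_∘_; Equivalence)
open import Function.Definitions using (Injective)
open import Relation.Nullary using (Dec; yes; no; ¬_; _×-dec_)
open import Relation.Nullary.Decidable using (dec-false)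
open import Relation.Unary using (Pred; Decidable)
open import Relation.Binary.PropositionalEquality
open import Algebra.Properties.CommutativeMonoid.Sum ℕ.+-0-commutativeMonoid
  using (sum-remove; sum-permute; sum-cong-≗) renaming (sum to ∑)

indicator : ∀ {P : Set} → Dec P → ℕ
indicator (yes _) = 1
indicator (no _)  = 0

length-filter-tabulate : ∀ {A : Set} {P : Pred A _} (P? : Decidable P) {m} (h : Fin m → A) →
  length (filter P? (tabulate h)) ≡ ∑ (λ i → indicator (P? (h i)))
length-filter-tabulate P? {zero}  h = refl
length-filter-tabulate P? {suc m} h with P? (h zero)
... | yes _ = cong suc (length-filter-tabulate P? (h ∘ suc))
... | no _  = length-filter-tabulate P? (h ∘ suc)

indicator-cong : ∀ {P Q : Set} (P? : Dec P) (Q? : Dec Q) → (P → Q) → (Q → P) → indicator P? ≡ indicator Q?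
indicator-cong (yes _) (yes _) _   _   = refl
indicator-cong (no _)  (no _)  _   _   = refl
indicator-cong (yes p) (no ¬q) p⇒q _   = ⊥-elim (¬q (p⇒q p))
indicator-cong (no ¬p) (yes q) _   q⇒p = ⊥-elim (¬p (q⇒p q))

indicator-no : ∀ {P : Set} (P? : Dec P) → ¬ P → indicator P? ≡ 0
indicator-no (yes p) ¬p = ⊥-elim (¬p p)
indicator-no (no _)  _  = refl

blockSize≡∑ : ∀ G {k} (f : Fin (n G) → Fin k) i → blockSize G f i ≡ ∑ (λ v → indicator (f v ≟ᶠ i))
blockSize≡∑ G f i = length-filter-tabulate (λ v → f v ≟ᶠ i) (λ v → v)

length≡1 : ∀ {A : Set} (xs : List A) → length xs ≡ 1 → Σ A λ x → xs ≡ x ∷ []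
length≡1 (x ∷ []) refl = x , refl
length≡1 []           ()
length≡1 (_ ∷ _ ∷ _)  ()

blockSize≡1⇒singleton : ∀ G {k} (f : Fin (n G) → Fin k) i → blockSize G f i ≡ 1 →
  Σ (Fin (n G)) λ x → f x ≡ i × (∀ v → f v ≡ i → v ≡ x)
blockSize≡1⇒singleton G f i size = x , f-x , unique
  where
  P? = λ v → f v ≟ᶠ i
  x = proj₁ (length≡1 (filter P? (allFin (n G))) size)
  block≡[x] = proj₂ (length≡1 (filter P? (allFin (n G))) size)
  f-x : f x ≡ i
  f-x = proj₂ (∈-filter⁻ P? {xs = allFin (n G)} (subst (x ∈_) (sym block≡[x]) (here refl)))
  unique : ∀ v → f v ≡ i → v ≡ x
  unique v f-v with subst (v ∈_) block≡[x] (∈-filter⁺ P? (∈-allFin v) f-v)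
  ... | here v≡x = v≡x

InducesConnected-pullback : ∀ {G H} {S : Fin (n G) → Set} {T : Fin (n H) → Set}
  (φ : Fin (n H) → Fin (n G)) → Injective _≡_ _≡_ φ →
  (∀ {a b} → adj G (φ a) (φ b) ≡ true → adj H a b ≡ true) →
  (∀ {a} → T a → S (φ a)) → (∀ {v} → S v → Σ (Fin (n H)) λ a → T a × φ a ≡ v) →
  InducesConnected G S → InducesConnected H T
InducesConnected-pullback {G} {H} {S} {T} φ φ-injective φ-reflects T⇒S S⇒T connected a b Ta Tb =
  lift (connected (φ a) (φ b) (T⇒S Ta) (T⇒S Tb)) refl refl
  where
  lift : ∀ {u v} → WalkIn G S u v → ∀ {a b} → φ a ≡ u → φ b ≡ v → WalkIn H T a b
  lift here φa≡u φb≡u = subst (WalkIn H T _) (φ-injective (trans φa≡u (sym φb≡u))) here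
  lift (step u~w Sw walk) refl φb≡v with S⇒T Sw
  ... | c , Tc , refl = step (φ-reflects u~w) Tc (lift walk refl φb≡v)

module _ {A : Set} {y : A} where

  inject∷ʳ : ∀ (xs : List A) → Fin (length xs) → Fin (length (xs ∷ʳ y))
  inject∷ʳ (_ ∷ _)  zero    = zero
  inject∷ʳ (_ ∷ xs) (suc i) = suc (inject∷ʳ xs i)

  last∷ʳ : ∀ (xs : List A) → Fin (length (xs ∷ʳ y))
  last∷ʳ []       = zero
  last∷ʳ (_ ∷ xs) = suc (last∷ʳ xs)

  lookup-inject∷ʳ : ∀ xs i → lookup (xs ∷ʳ y) (inject∷ʳ xs i) ≡ lookup xs i
  lookup-inject∷ʳ (_ ∷ _)  zero    = refl
  lookup-inject∷ʳ (_ ∷ xs) (suc i) = lookup-inject∷ʳ xs i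

  lookup-last∷ʳ : ∀ xs → lookup (xs ∷ʳ y) (last∷ʳ xs) ≡ y
  lookup-last∷ʳ []       = refl
  lookup-last∷ʳ (_ ∷ xs) = lookup-last∷ʳ xs

  inject∷ʳ-injective : ∀ xs → Injective _≡_ _≡_ (inject∷ʳ xs)
  inject∷ʳ-injective (_ ∷ _)  {zero}  {zero}  _  = refl
  inject∷ʳ-injective (_ ∷ xs) {suc i} {suc j} eq = cong suc (inject∷ʳ-injective xs (suc-injective eq))

  inject∷ʳ≢last∷ʳ : ∀ xs i → inject∷ʳ xs i ≢ last∷ʳ xs
  inject∷ʳ≢last∷ʳ (_ ∷ xs) (suc i) eq = inject∷ʳ≢last∷ʳ xs i (suc-injective eq)

  inject∷ʳ-surjective : ∀ xs j → j ≢ last∷ʳ xs → Σ (Fin (length xs)) λ i → inject∷ʳ xs i ≡ j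
  inject∷ʳ-surjective []       zero    j≢last = ⊥-elim (j≢last refl)
  inject∷ʳ-surjective (_ ∷ xs) zero    _      = zero , refl
  inject∷ʳ-surjective (_ ∷ xs) (suc j) j≢last =
    let (i , i↦j) = inject∷ʳ-surjective xs j (j≢last ∘ cong suc) in suc i , cong suc i↦j

Linked-∷ʳ-1 : ∀ {μ} → All NonZero μ → Linked _≥_ μ → Linked _≥_ (μ ∷ʳ 1)
Linked-∷ʳ-1 {[]}    _               _         = [-]
Linked-∷ʳ-1 {suc _ ∷ []} _          _         = s≤s z≤n ∷ [-]
Linked-∷ʳ-1 {_ ∷ _ ∷ _} (_ ∷ nonzero) (m≥m′ ∷ linked) = m≥m′ ∷ Linked-∷ʳ-1 nonzero linked

IsPartition-∷ʳ-1 : ∀ {m μ} → IsPartition m μ → IsPartition (suc m) (μ ∷ʳ 1)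
IsPartition-∷ʳ-1 {m} {μ} (nonzero , linked , sum≡m) =
  All.∷ʳ⁺ nonzero _ , Linked-∷ʳ-1 nonzero linked ,
  trans (sum-++ μ (1 ∷ [])) (trans (cong (_+ 1) sum≡m) (ℕ.+-comm m 1))

_─_ : (G : Graph) → Fin (n G) → Graph
record { n = suc N ; adj = a } ─ x = record { n = N ; adj = λ i j → a (punchIn x i) (punchIn x j) }

deleteSingletonBlock : ∀ G μ → HasConnectedPartitionOfType G (μ ∷ʳ 1) →
  Σ (Fin (n G)) λ x → HasConnectedPartitionOfType (G ─ x) μ
deleteSingletonBlock record { n = zero } μ (f , blocks) =
  ⊥-elim (ℕ.0≢1+n (trans (proj₁ (blocks (last∷ʳ μ))) (lookup-last∷ʳ μ)))
deleteSingletonBlock G@record { n = suc N } μ (f , blocks)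
  with blockSize≡1⇒singleton G f (last∷ʳ μ) (trans (proj₁ (blocks (last∷ʳ μ))) (lookup-last∷ʳ μ))
... | x , f-x , only-x = x , g , λ i → size i , connected i
  where
  last = last∷ʳ μ
  f∘punchIn≢last : ∀ j → f (punchIn x j) ≢ last
  f∘punchIn≢last j = punchInᵢ≢i x j ∘ only-x (punchIn x j)
  g : Fin N → Fin (length μ)
  g j = proj₁ (inject∷ʳ-surjective μ (f (punchIn x j)) (f∘punchIn≢last j))
  inject-g : ∀ j → inject∷ʳ μ (g j) ≡ f (punchIn x j)
  inject-g j = proj₂ (inject∷ʳ-surjective μ (f (punchIn x j)) (f∘punchIn≢last j))
  g≡⇒ : ∀ {j i} → g j ≡ i → f (punchIn x j) ≡ inject∷ʳ μ i
  g≡⇒ {j} refl = sym (inject-g j)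
  g≡⇐ : ∀ {j i} → f (punchIn x j) ≡ inject∷ʳ μ i → g j ≡ i
  g≡⇐ {j} eq = inject∷ʳ-injective μ (trans (inject-g j) eq)
  f-x≢inject : ∀ i → f x ≢ inject∷ʳ μ i
  f-x≢inject i eq = inject∷ʳ≢last∷ʳ μ i (trans (sym eq) f-x)
  size : ∀ i → blockSize (G ─ x) g i ≡ lookup μ i
  size i = begin
    blockSize (G ─ x) g i                     ≡⟨ blockSize≡∑ (G ─ x) g i ⟩
    ∑ (λ j → indicator (g j ≟ᶠ i))
      ≡⟨ sum-cong-≗ (λ j → indicator-cong (g j ≟ᶠ i) _ g≡⇒ g≡⇐) ⟩
    ∑ (t ∘ punchIn x)
      ≡⟨ cong (_+ ∑ (t ∘ punchIn x)) (sym (indicator-no (f x ≟ᶠ i′) (f-x≢inject i))) ⟩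
    t x + ∑ (t ∘ punchIn x)                   ≡⟨ sym (sum-remove t) ⟩
    ∑ t                                       ≡⟨ sym (blockSize≡∑ G f i′) ⟩
    blockSize G f i′                          ≡⟨ proj₁ (blocks i′) ⟩
    lookup (μ ∷ʳ 1) i′                        ≡⟨ lookup-inject∷ʳ μ i ⟩
    lookup μ i                                ∎
    where
    open ≡-Reasoning
    i′ = inject∷ʳ μ i
    t = λ v → indicator (f v ≟ᶠ i′)
  connected : ∀ i → InducesConnected (G ─ x) (λ j → g j ≡ i)
  connected i = InducesConnected-pullback (punchIn x) (punchIn-injective x _ _) (λ a~b → a~b) g≡⇒ S⇒T
    (proj₂ (blocks (inject∷ʳ μ i)))
    where
    S⇒T : ∀ {v} → f v ≡ inject∷ʳ μ i → Σ (Fin N) λ a → g a ≡ i × punchIn x a ≡ v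
    S⇒T {v} f-v with x ≟ᶠ v
    ... | yes refl = ⊥-elim (f-x≢inject i f-v)
    ... | no x≢v = punchOut x≢v , g≡⇐ (trans (cong f (punchIn-punchOut x≢v)) f-v) , punchIn-punchOut x≢v

record BijectiveHomomorphism (G H : Graph) : Set where
  field
    bijection : Permutation (n G) (n H)
    preserves-adj : ∀ {u v} → adj G u v ≡ true → adj H (bijection ⟨$⟩ʳ u) (bijection ⟨$⟩ʳ v) ≡ true

transportConnectedPartition : ∀ {G H μ} → BijectiveHomomorphism G H →
  HasConnectedPartitionOfType G μ → HasConnectedPartitionOfType H μ
transportConnectedPartition {G} {H} {μ} φ (f , blocks) = f ∘ (π ⟨$⟩ˡ_) , λ i → size i , connected i
  where
  open BijectiveHomomorphism φ renaming (bijection to π)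
  size : ∀ i → blockSize H (f ∘ (π ⟨$⟩ˡ_)) i ≡ lookup μ i
  size i = begin
    blockSize H (f ∘ (π ⟨$⟩ˡ_)) i                  ≡⟨ blockSize≡∑ H _ i ⟩
    ∑ (λ w → indicator (f (π ⟨$⟩ˡ w) ≟ᶠ i))         ≡⟨ sum-permute _ π ⟩
    ∑ (λ v → indicator (f (π ⟨$⟩ˡ (π ⟨$⟩ʳ v)) ≟ᶠ i))
      ≡⟨ sum-cong-≗ (λ v → cong (λ u → indicator (f u ≟ᶠ i)) (inverseˡ π {v})) ⟩
    ∑ (λ v → indicator (f v ≟ᶠ i))                 ≡⟨ sym (blockSize≡∑ G f i) ⟩
    blockSize G f i                                ≡⟨ proj₁ (blocks i) ⟩
    lookup μ i                                     ∎
    where open ≡-Reasoning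
  connected : ∀ i → InducesConnected H (λ w → f (π ⟨$⟩ˡ w) ≡ i)
  connected i = InducesConnected-pullback (π ⟨$⟩ˡ_) πˡ-injective reflects (λ fa → fa)
    (λ {v} f-v → π ⟨$⟩ʳ v , trans (cong f (inverseˡ π)) f-v , inverseˡ π) (proj₂ (blocks i))
    where
    πˡ-injective : Injective _≡_ _≡_ (π ⟨$⟩ˡ_)
    πˡ-injective eq = trans (sym (inverseʳ π)) (trans (cong (π ⟨$⟩ʳ_) eq) (inverseʳ π))
    reflects : ∀ {a b} → adj G (π ⟨$⟩ˡ a) (π ⟨$⟩ˡ b) ≡ true → adj H a b ≡ true
    reflects a~b = subst₂ (λ a b → adj H a b ≡ true) (inverseʳ π) (inverseʳ π) (preserves-adj a~b)

∨-intro : ∀ p q → T p ⊎ T q → T (p ∨ q)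
∨-intro _ _ = Equivalence.from T-∨

∨-intro⁴ : ∀ p q r s → T p ⊎ T q ⊎ T r ⊎ T s → T (p ∨ q ∨ r ∨ s)
∨-intro⁴ p q r s = ∨-intro p _ ∘ map₂ (∨-intro q _ ∘ map₂ (∨-intro r s))

Unique-concatMap : ∀ {A B : Set} (key : B → A) (f : A → List B) {xs} → Unique xs →
  (∀ x → Unique (f x)) → (∀ x {y} → y ∈ f x → key y ≡ x) → Unique (concatMap f xs)
Unique-concatMap key f {xs} xs-unique f-unique f-key =
  concat⁺ (All.map⁺ (All.universal f-unique xs)) (AllPairs.map⁺ (AllPairs.map disjoint xs-unique))
  where
  disjoint : ∀ {x x′} → x ≢ x′ → Disjoint (f x) (f x′)
  disjoint x≢x′ (y∈fx , y∈fx′) = x≢x′ (trans (sym (f-key _ y∈fx)) (f-key _ y∈fx′))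

lookup-injective : ∀ {A : Set} {xs : List A} → Unique xs → ∀ {i j} → lookup xs i ≡ lookup xs j → i ≡ j
lookup-injective {xs = _ ∷ xs} (_ ∷ _)         {zero}  {zero}  _  = refl
lookup-injective {xs = _ ∷ xs} (x∉xs ∷ _)      {zero}  {suc j} eq =
  ⊥-elim (All.lookup x∉xs (∈-lookup {xs = xs} j) eq)
lookup-injective {xs = _ ∷ xs} (x∉xs ∷ _)      {suc i} {zero}  eq =
  ⊥-elim (All.lookup x∉xs (∈-lookup {xs = xs} i) (sym eq))
lookup-injective {xs = _ ∷ xs} (_ ∷ xs-unique) {suc i} {suc j} eq = cong suc (lookup-injective xs-unique eq)

module EdgeList (G : Graph) where

  cell : Fin (n G) → Fin (n G) → List (Fin (n G) × Fin (n G))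
  cell i j = if (toℕ i <ᵇ toℕ j) ∧ adj G i j then (i , j) ∷ [] else []

  row : Fin (n G) → List (Fin (n G) × Fin (n G))
  row i = concatMap (cell i) (allFin (n G))

  ∈-cell⁻ : ∀ {i j z} → z ∈ cell i j → z ≡ (i , j) × (toℕ i < toℕ j × adj G i j ≡ true)
  ∈-cell⁻ {i} {j} z∈ with (toℕ i <ᵇ toℕ j) ∧ adj G i j in c
  ∈-cell⁻ {i} {j} (here refl) | true =
    let (i<j , i~j) = Equivalence.to T-∧ (Equivalence.from T-≡ c) in
    refl , <ᵇ⇒< _ _ i<j , Equivalence.to T-≡ i~j

  cell-unique : ∀ i j → Unique (cell i j)
  cell-unique i j with (toℕ i <ᵇ toℕ j) ∧ adj G i j
  ... | true  = [] ∷ []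
  ... | false = []

  ∈-edgesOf⁻ : ∀ {i j} → (i , j) ∈ edgesOf G → toℕ i < toℕ j × adj G i j ≡ true
  ∈-edgesOf⁻ ij∈ with satisfied (∈-concatMap⁻ row {xs = allFin (n G)} ij∈)
  ... | i′ , ij∈row with satisfied (∈-concatMap⁻ (cell i′) {xs = allFin (n G)} ij∈row)
  ... | j′ , ij∈cell with ∈-cell⁻ ij∈cell
  ... | refl , i<j , i~j = i<j , i~j

  ∈-edgesOf⁺ : ∀ {i j} → toℕ i < toℕ j → adj G i j ≡ true → (i , j) ∈ edgesOf G
  ∈-edgesOf⁺ {i} {j} i<j i~j =
    ∈-concatMap⁺ row (lose (∈-allFin i) (∈-concatMap⁺ (cell i) (lose (∈-allFin j) ij∈cell)))
    where
    ij∈cell : (i , j) ∈ cell i j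
    ij∈cell rewrite Equivalence.to T-≡ (<⇒<ᵇ i<j) | i~j = here refl

  edgesOf-unique : Unique (edgesOf G)
  edgesOf-unique = Unique-concatMap proj₁ row (allFin⁺ (n G)) row-unique row-key
    where
    row-unique : ∀ i → Unique (row i)
    row-unique i = Unique-concatMap proj₂ (cell i) (allFin⁺ (n G)) (cell-unique i)
      (λ j z∈ → cong proj₂ (proj₁ (∈-cell⁻ z∈)))
    row-key : ∀ i {z} → z ∈ row i → proj₁ z ≡ i
    row-key i z∈ with satisfied (∈-concatMap⁻ (cell i) {xs = allFin (n G)} z∈)
    ... | j , z∈cell = cong proj₁ (proj₁ (∈-cell⁻ z∈cell))

  Endpoint : ℕ → Fin (length (edgesOf G)) → Set
  Endpoint v e = v ≡ toℕ (proj₁ (lookup (edgesOf G) e)) ⊎ v ≡ toℕ (proj₂ (lookup (edgesOf G) e))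

  lineGraph-adj : ∀ {e f} v → toℕ e ≢ toℕ f → Endpoint v e → Endpoint v f →
    adj (lineGraph G) e f ≡ true
  lineGraph-adj {e} {f} v e≢f v∈e v∈f = Equivalence.to T-≡ (Equivalence.from T-∧
    ( Equivalence.from T-not-≡ (dec-false (toℕ e ℕ.≟ toℕ f) e≢f)
    , ∨-intro⁴ (a ≡ᵇ c) (a ≡ᵇ d) (b ≡ᵇ c) (b ≡ᵇ d) (shared v∈e v∈f)))
    where
    a = toℕ (proj₁ (lookup (edgesOf G) e))
    b = toℕ (proj₂ (lookup (edgesOf G) e))
    c = toℕ (proj₁ (lookup (edgesOf G) f))
    d = toℕ (proj₂ (lookup (edgesOf G) f))
    shared : ∀ {a b c d} → v ≡ a ⊎ v ≡ b → v ≡ c ⊎ v ≡ d →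
      T (a ≡ᵇ c) ⊎ T (a ≡ᵇ d) ⊎ T (b ≡ᵇ c) ⊎ T (b ≡ᵇ d)
    shared (inj₁ refl) (inj₁ refl) = inj₁ (≡⇒≡ᵇ v v refl)
    shared (inj₁ refl) (inj₂ refl) = inj₂ (inj₁ (≡⇒≡ᵇ v v refl))
    shared (inj₂ refl) (inj₁ refl) = inj₂ (inj₂ (inj₁ (≡⇒≡ᵇ v v refl)))
    shared (inj₂ refl) (inj₂ refl) = inj₂ (inj₂ (inj₂ (≡⇒≡ᵇ v v refl)))

∈-pathEdges⁻ : ∀ a l {c b} → (c , b) ∈ pathEdges a l → a < b × b ≤ a + l × suc c ≡ b
∈-pathEdges⁻ a (suc l) (here refl) = ℕ.n<1+n a , ℕ.m<m+n a (s≤s z≤n) , refl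
∈-pathEdges⁻ a (suc l) {b = b} (there b∈) with ∈-pathEdges⁻ (suc a) l b∈
... | a<b , b≤ , c↦b = ℕ.<-trans (ℕ.n<1+n a) a<b , subst (b ≤_) (sym (ℕ.+-suc a l)) b≤ , c↦b

∈-pathEdges⁺ : ∀ a l {b} → a < b → b ≤ a + l → (pred b , b) ∈ pathEdges a l
∈-pathEdges⁺ a zero    {b} a<b b≤a+0 = ⊥-elim (ℕ.<⇒≱ a<b (subst (b ≤_) (ℕ.+-identityʳ a) b≤a+0))
∈-pathEdges⁺ a (suc l) {b} a<b b≤ with b ℕ.≟ suc a
... | yes refl = here refl
... | no b≢1+a =
  there (∈-pathEdges⁺ (suc a) l (ℕ.≤∧≢⇒< a<b (b≢1+a ∘ sym)) (subst (b ≤_) (ℕ.+-suc a l) b≤))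

∈-legEdges⁻ : ∀ s l {c b} → (c , b) ∈ legEdges s l → s < b × b ≤ s + l × (c ≡ 0 ⊎ suc c ≡ b)
∈-legEdges⁻ s (suc l) (here refl) = ℕ.n<1+n s , ℕ.m<m+n s (s≤s z≤n) , inj₁ refl
∈-legEdges⁻ s (suc l) {b = b} (there b∈) with ∈-pathEdges⁻ (suc s) l b∈
... | s<b , b≤ , c↦b = ℕ.<-trans (ℕ.n<1+n s) s<b , subst (b ≤_) (sym (ℕ.+-suc s l)) b≤ , inj₂ c↦b

∈-legEdges⁺ : ∀ s l {b} → s < b → b ≤ s + l → Σ ℕ λ c → (c , b) ∈ legEdges s l
∈-legEdges⁺ s zero    {b} s<b b≤s+0 = ⊥-elim (ℕ.<⇒≱ s<b (subst (b ≤_) (ℕ.+-identityʳ s) b≤s+0))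
∈-legEdges⁺ s (suc l) {b} s<b b≤ with b ℕ.≟ suc s
... | yes refl = 0 , here refl
... | no b≢1+s =
  pred b , there (∈-pathEdges⁺ (suc s) l (ℕ.≤∧≢⇒< s<b (b≢1+s ∘ sym)) (subst (b ≤_) (ℕ.+-suc s l) b≤))

legEdges-functional : ∀ s l {c c′ b} → (c , b) ∈ legEdges s l → (c′ , b) ∈ legEdges s l → c ≡ c′
legEdges-functional s (suc l) (here refl) (here refl) = refl
legEdges-functional s (suc l) (here refl) (there b∈)  =
  ⊥-elim (ℕ.<-irrefl refl (proj₁ (∈-pathEdges⁻ (suc s) l b∈)))
legEdges-functional s (suc l) (there b∈)  (here refl) =
  ⊥-elim (ℕ.<-irrefl refl (proj₁ (∈-pathEdges⁻ (suc s) l b∈)))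
legEdges-functional s (suc l) (there b∈)  (there b∈′) =
  let (_ , _ , c↦b) = ∈-pathEdges⁻ (suc s) l b∈ ; (_ , _ , c′↦b) = ∈-pathEdges⁻ (suc s) l b∈′
  in ℕ.suc-injective (trans c↦b (sym c′↦b))

∈-spiderEdgesFrom⁻ : ∀ s ls {c b} → (c , b) ∈ spiderEdgesFrom s ls →
  s < b × b ≤ s + sum ls × (c ≡ 0 ⊎ suc c ≡ b)
∈-spiderEdgesFrom⁻ s (l ∷ ls) {b = b} b∈ with ∈-++⁻ (legEdges s l) b∈
... | inj₁ b∈leg with ∈-legEdges⁻ s l b∈leg
...   | s<b , b≤ , c↦b = s<b , ℕ.≤-trans b≤ (ℕ.+-monoʳ-≤ s (ℕ.m≤m+n l (sum ls))) , c↦b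
∈-spiderEdgesFrom⁻ s (l ∷ ls) {b = b} b∈ | inj₂ b∈rest with ∈-spiderEdgesFrom⁻ (s + l) ls b∈rest
...   | s+l<b , b≤ , c↦b =
  ℕ.≤-<-trans (ℕ.m≤m+n s l) s+l<b , subst (b ≤_) (ℕ.+-assoc s l (sum ls)) b≤ , c↦b

∈-spiderEdgesFrom⁺ : ∀ s ls {b} → s < b → b ≤ s + sum ls → Σ ℕ λ c → (c , b) ∈ spiderEdgesFrom s ls
∈-spiderEdgesFrom⁺ s []       {b} s<b b≤s+0 =
  ⊥-elim (ℕ.<⇒≱ s<b (subst (b ≤_) (ℕ.+-identityʳ s) b≤s+0))
∈-spiderEdgesFrom⁺ s (l ∷ ls) {b} s<b b≤ with b ℕ.≤? s + l
... | yes b≤s+l = let (c , b∈) = ∈-legEdges⁺ s l s<b b≤s+l in c , ∈-++⁺ˡ b∈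
... | no b≰s+l  =
  let (c , b∈) = ∈-spiderEdgesFrom⁺ (s + l) ls (ℕ.≰⇒> b≰s+l)
                   (subst (b ≤_) (sym (ℕ.+-assoc s l (sum ls))) b≤)
  in c , ∈-++⁺ʳ (legEdges s l) b∈

legEdges-disjoint-rest : ∀ s l ls {c c′ b} →
  (c , b) ∈ legEdges s l → (c′ , b) ∈ spiderEdgesFrom (s + l) ls → ⊥
legEdges-disjoint-rest s l ls b∈leg b∈rest =
  ℕ.<⇒≱ (proj₁ (∈-spiderEdgesFrom⁻ (s + l) ls b∈rest)) (proj₁ (proj₂ (∈-legEdges⁻ s l b∈leg)))

spiderEdgesFrom-functional : ∀ s ls {c c′ b} →
  (c , b) ∈ spiderEdgesFrom s ls → (c′ , b) ∈ spiderEdgesFrom s ls → c ≡ c′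
spiderEdgesFrom-functional s (l ∷ ls) b∈ b∈′ with ∈-++⁻ (legEdges s l) b∈ | ∈-++⁻ (legEdges s l) b∈′
... | inj₁ b∈leg  | inj₁ b∈leg′  = legEdges-functional s l b∈leg b∈leg′
... | inj₂ b∈rest | inj₂ b∈rest′ = spiderEdgesFrom-functional (s + l) ls b∈rest b∈rest′
... | inj₁ b∈leg  | inj₂ b∈rest′ = ⊥-elim (legEdges-disjoint-rest s l ls b∈leg b∈rest′)
... | inj₂ b∈rest | inj₁ b∈leg′  = ⊥-elim (legEdges-disjoint-rest s l ls b∈leg′ b∈rest)

module SpiderTree (λs : List ℕ) where

  N : ℕ
  N = sum λs

  Edge : ℕ → ℕ → Set
  Edge c b = (c , b) ∈ spiderEdgesFrom 0 λs

  -- Junk value 0 at the centre and beyond N; legStart 0 relies on parent 0 ≡ 0.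
  parent : ℕ → ℕ
  parent b with 1 ℕ.≤? b | b ℕ.≤? N
  ... | yes 1≤b | yes b≤N = proj₁ (∈-spiderEdgesFrom⁺ 0 λs 1≤b b≤N)
  ... | _       | _       = 0

  Edge-parent : ∀ {b} → 1 ≤ b → b ≤ N → Edge (parent b) b
  Edge-parent {b} 1≤b b≤N with 1 ℕ.≤? b | b ℕ.≤? N
  ... | yes 1≤b′ | yes b≤N′ = proj₂ (∈-spiderEdgesFrom⁺ 0 λs 1≤b′ b≤N′)
  ... | no 1≰b   | _        = ⊥-elim (1≰b 1≤b)
  ... | yes _    | no b≰N   = ⊥-elim (b≰N b≤N)

  Edge-bounds : ∀ {c b} → Edge c b → 1 ≤ b × b ≤ N
  Edge-bounds c↦b = let (1≤b , b≤N , _) = ∈-spiderEdgesFrom⁻ 0 λs c↦b in 1≤b , b≤N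

  Edge⇒parent : ∀ {c b} → Edge c b → parent b ≡ c
  Edge⇒parent c↦b = let (1≤b , b≤N) = Edge-bounds c↦b in
    spiderEdgesFrom-functional 0 λs (Edge-parent 1≤b b≤N) c↦b

  parent-cases : ∀ {b} → 1 ≤ b → b ≤ N → parent b ≡ 0 ⊎ suc (parent b) ≡ b
  parent-cases 1≤b b≤N = proj₂ (proj₂ (∈-spiderEdgesFrom⁻ 0 λs (Edge-parent 1≤b b≤N)))

  parent< : ∀ {b} → 1 ≤ b → b ≤ N → parent b < b
  parent< {b} 1≤b b≤N with parent-cases 1≤b b≤N
  ... | inj₁ p≡0 = subst (_< b) (sym p≡0) 1≤b
  ... | inj₂ p↦b = subst (parent b <_) p↦b (ℕ.n<1+n (parent b))

  Edge⇒< : ∀ {c b} → Edge c b → c < b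
  Edge⇒< c↦b = let (1≤b , b≤N) = Edge-bounds c↦b in subst (_< _) (Edge⇒parent c↦b) (parent< 1≤b b≤N)

  -- The path from the centre to x is 0, start, start + 1, …, x (just 0 when x = 0).
  record LegStart (x : ℕ) : Set where
    field
      start        : ℕ
      start≤x      : start ≤ x
      start>0    : 0 < x → 0 < start
      parent-start : parent start ≡ 0
      parent-leg   : ∀ {m} → start < m → m ≤ x → suc (parent m) ≡ m

  legStart : ∀ x → x ≤ N → LegStart x
  legStart zero _ = record
    { start = 0 ; start≤x = z≤n ; start>0 = λ () ; parent-start = refl
    ; parent-leg = λ 0<m m≤0 → ⊥-elim (ℕ.<⇒≱ 0<m m≤0) }
  legStart (suc x) 1+x≤N with parent (suc x) ℕ.≟ 0 | parent-cases (s≤s z≤n) 1+x≤N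
  ... | yes p≡0 | _       = record
    { start = suc x ; start≤x = ℕ.≤-refl ; start>0 = λ _ → s≤s z≤n ; parent-start = p≡0
    ; parent-leg = λ 1+x<m m≤1+x → ⊥-elim (ℕ.<⇒≱ 1+x<m m≤1+x) }
  ... | no p≢0  | inj₁ p≡0 = ⊥-elim (p≢0 p≡0)
  ... | no p≢0  | inj₂ p↦1+x = record
    { start = start ; start≤x = ℕ.m≤n⇒m≤1+n start≤x ; start>0 = λ _ → start>0 0<x
    ; parent-start = parent-start ; parent-leg = parent-leg′ }
    where
    0<x : 0 < x
    0<x = ℕ.n≢0⇒n>0 λ { refl → p≢0 (ℕ.suc-injective p↦1+x) }
    open LegStart (legStart x (ℕ.≤-trans (ℕ.n≤1+n x) 1+x≤N))
    parent-leg′ : ∀ {m} → start < m → m ≤ suc x → suc (parent m) ≡ m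
    parent-leg′ {m} start<m m≤1+x with m ℕ.≟ suc x
    ... | yes refl = p↦1+x
    ... | no m≢1+x = parent-leg start<m (s≤s⁻¹ (ℕ.≤∧≢⇒< m≤1+x m≢1+x))

  Incident : ℕ → ℕ → Set
  Incident v k = v ≡ parent k ⊎ v ≡ k

  module Towards (x : ℕ) (x≤N : x ≤ N) where
    open LegStart (legStart x x≤N)

    OnLeg : ℕ → Set
    OnLeg k = start ≤ k × k ≤ x

    onLeg? : ∀ k → Dec (OnLeg k)
    onLeg? k = start ℕ.≤? k ×-dec k ℕ.≤? x

    -- Edges are named by their endpoint farther from the centre, the other one being its
    -- parent; towards v names the first edge on the path from v to x.
    towards : ℕ → ℕ
    towards zero = start
    towards (suc v) with onLeg? (suc v)
    ... | yes _ = suc (suc v)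
    ... | no _  = suc v

    towards⁻¹ : ℕ → ℕ
    towards⁻¹ k with onLeg? k
    ... | yes _ = parent k
    ... | no _  = k

    towards-onLeg : ∀ {v} → v ≢ 0 → OnLeg v → towards v ≡ suc v
    towards-onLeg {zero}  v≢0 _ = ⊥-elim (v≢0 refl)
    towards-onLeg {suc v} _ on with onLeg? (suc v)
    ... | yes _ = refl
    ... | no off = ⊥-elim (off on)

    towards-offLeg : ∀ {v} → v ≢ 0 → ¬ OnLeg v → towards v ≡ v
    towards-offLeg {zero}  v≢0 _ = ⊥-elim (v≢0 refl)
    towards-offLeg {suc v} _ off with onLeg? (suc v)
    ... | yes on = ⊥-elim (off on)
    ... | no _ = refl

    towards⁻¹-onLeg : ∀ {k} → OnLeg k → towards⁻¹ k ≡ parent k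
    towards⁻¹-onLeg {k} on with onLeg? k
    ... | yes _ = refl
    ... | no off = ⊥-elim (off on)

    towards⁻¹-offLeg : ∀ {k} → ¬ OnLeg k → towards⁻¹ k ≡ k
    towards⁻¹-offLeg {k} off with onLeg? k
    ... | yes on = ⊥-elim (off on)
    ... | no _ = refl

    onLeg-x : OnLeg x
    onLeg-x = start≤x , ℕ.≤-refl

    onLeg-start : OnLeg start
    onLeg-start = ℕ.≤-refl , start≤x

    parent-suc : ∀ {v} → OnLeg v → v ≢ x → parent (suc v) ≡ v
    parent-suc (start≤v , v≤x) v≢x = ℕ.suc-injective (parent-leg (s≤s start≤v) (ℕ.≤∧≢⇒< v≤x v≢x))

    onLeg-suc : ∀ {v} → OnLeg v → v ≢ x → OnLeg (suc v)
    onLeg-suc (start≤v , v≤x) v≢x = ℕ.m≤n⇒m≤1+n start≤v , ℕ.≤∧≢⇒< v≤x v≢x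

    towards-parent : ∀ {k} → OnLeg k → towards (parent k) ≡ k
    towards-parent {k} (start≤k , k≤x) with start ℕ.≟ k
    ... | yes refl = cong towards parent-start
    ... | no start≢k =
      trans (towards-onLeg p≢0 (start≤p , ℕ.≤-trans (ℕ.n≤1+n _) (subst (_≤ x) (sym p↦k) k≤x))) p↦k
      where
      start<k = ℕ.≤∧≢⇒< start≤k start≢k
      p↦k : suc (parent k) ≡ k
      p↦k = parent-leg start<k k≤x
      start≤p : start ≤ parent k
      start≤p = s≤s⁻¹ (subst (suc start ≤_) (sym p↦k) start<k)
      p≢0 : parent k ≢ 0
      p≢0 p≡0 = ℕ.<⇒≱ (start>0 (ℕ.<-≤-trans (ℕ.≤-<-trans z≤n start<k) k≤x))
                       (subst (start ≤_) p≡0 start≤p)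

    towards-bounds : ∀ {v} → v ≤ N → v ≢ x → 1 ≤ towards v × towards v ≤ N
    towards-bounds {zero} _ 0≢x = start>0 (ℕ.n≢0⇒n>0 (0≢x ∘ sym)) , ℕ.≤-trans start≤x x≤N
    towards-bounds {suc v} v≤N v≢x with onLeg? (suc v)
    ... | yes (_ , v≤x) = s≤s z≤n , ℕ.≤-trans (ℕ.≤∧≢⇒< v≤x v≢x) x≤N
    ... | no _          = s≤s z≤n , v≤N

    towards⁻¹-bounds : ∀ {k} → 1 ≤ k → k ≤ N → towards⁻¹ k ≤ N × towards⁻¹ k ≢ x
    towards⁻¹-bounds {k} 1≤k k≤N with onLeg? k
    ... | yes (_ , k≤x) =
      ℕ.≤-trans (ℕ.<⇒≤ p<k) k≤N , λ p≡x → ℕ.<⇒≱ p<k (subst (k ≤_) (sym p≡x) k≤x)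
      where p<k = parent< 1≤k k≤N
    ... | no off = k≤N , λ { refl → off onLeg-x }

    towards-towards⁻¹ : ∀ {k} → 1 ≤ k → k ≤ N → towards (towards⁻¹ k) ≡ k
    towards-towards⁻¹ {k} 1≤k _ with onLeg? k
    ... | yes on = towards-parent on
    ... | no off = towards-offLeg (ℕ.n>0⇒n≢0 1≤k) off

    towards⁻¹-towards : ∀ {v} → v ≢ x → towards⁻¹ (towards v) ≡ v
    towards⁻¹-towards {zero} _ = trans (towards⁻¹-onLeg onLeg-start) parent-start
    towards⁻¹-towards {suc v} v≢x with onLeg? (suc v)
    ... | yes on = trans (towards⁻¹-onLeg (onLeg-suc on v≢x)) (parent-suc on v≢x)
    ... | no off = towards⁻¹-offLeg off

    incident-towards : ∀ {v} → v ≢ x → Incident v (towards v)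
    incident-towards {zero} _ = inj₁ (sym parent-start)
    incident-towards {suc v} v≢x with onLeg? (suc v)
    ... | yes on = inj₁ (sym (parent-suc on v≢x))
    ... | no _   = inj₂ refl

    towards-Edge : ∀ {u w} → Edge u w → towards w ≡ w ⊎ towards u ≡ w
    towards-Edge {u} {w} u↦w with onLeg? w
    ... | yes on = inj₂ (trans (cong towards (sym (Edge⇒parent u↦w))) (towards-parent on))
    ... | no off = inj₁ (towards-offLeg (ℕ.n>0⇒n≢0 (proj₁ (Edge-bounds u↦w))) off)

    towards-Edge-adjacent : ∀ {u w} → Edge u w → u ≢ x → w ≢ x →
      towards u ≢ towards w × Σ ℕ λ v → Incident v (towards u) × Incident v (towards w)
    towards-Edge-adjacent {u} {w} u↦w u≢x w≢x = distinct , shared (towards-Edge u↦w)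
      where
      distinct : towards u ≢ towards w
      distinct eq = ℕ.<-irrefl (trans (sym (towards⁻¹-towards u≢x))
                      (trans (cong towards⁻¹ eq) (towards⁻¹-towards w≢x))) (Edge⇒< u↦w)
      shared : towards w ≡ w ⊎ towards u ≡ w → Σ ℕ λ v → Incident v (towards u) × Incident v (towards w)
      shared (inj₁ w↦w) =
        u , incident-towards u≢x , inj₁ (trans (sym (Edge⇒parent u↦w)) (cong parent (sym w↦w)))
      shared (inj₂ u↦w) = w , inj₂ (sym u↦w) , incident-towards w≢x

    towards-adjacent : ∀ {u w} → Edge u w ⊎ Edge w u → u ≢ x → w ≢ x →
      towards u ≢ towards w × Σ ℕ λ v → Incident v (towards u) × Incident v (towards w)
    towards-adjacent (inj₁ u↦w) u≢x w≢x = towards-Edge-adjacent u↦w u≢x w≢x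
    towards-adjacent (inj₂ w↦u) u≢x w≢x =
      let (distinct , v , v∈w , v∈u) = towards-Edge-adjacent w↦u w≢x u≢x
      in distinct ∘ sym , v , v∈u , v∈w

module SpiderLineGraph (λs : List ℕ) where
  open SpiderTree λs
  open EdgeList (spider λs)

  spider-adj⁻ : ∀ {u v} → adj (spider λs) u v ≡ true → Edge (toℕ u) (toℕ v) ⊎ Edge (toℕ v) (toℕ u)
  spider-adj⁻ u~v with find (any⁻ _ (spiderEdgesFrom 0 λs) (Equivalence.from T-≡ u~v))
  ... | (c , b) , cb∈ , matches with Equivalence.to T-∨ matches
  ... | inj₁ uv = let (u≡c , v≡b) = Equivalence.to T-∧ uv in
    inj₁ (subst₂ Edge (sym (≡ᵇ⇒≡ _ _ u≡c)) (sym (≡ᵇ⇒≡ _ _ v≡b)) cb∈)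
  ... | inj₂ vu = let (v≡c , u≡b) = Equivalence.to T-∧ vu in
    inj₂ (subst₂ Edge (sym (≡ᵇ⇒≡ _ _ v≡c)) (sym (≡ᵇ⇒≡ _ _ u≡b)) cb∈)

  spider-adj⁺ : ∀ {u v} → Edge (toℕ u) (toℕ v) → adj (spider λs) u v ≡ true
  spider-adj⁺ {u} {v} u↦v = Equivalence.to T-≡ (any⁺ _ (lose u↦v
    (∨-intro ((toℕ u ≡ᵇ toℕ u) ∧ (toℕ v ≡ᵇ toℕ v)) _
      (inj₁ (Equivalence.from (T-∧ {toℕ u ≡ᵇ toℕ u})
                (≡⇒≡ᵇ (toℕ u) _ refl , ≡⇒≡ᵇ (toℕ v) _ refl))))))

  ∈-edgesOf⇒Edge : ∀ {i j} → (i , j) ∈ edgesOf (spider λs) → Edge (toℕ i) (toℕ j)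
  ∈-edgesOf⇒Edge ij∈ with ∈-edgesOf⁻ ij∈
  ... | i<j , i~j with spider-adj⁻ i~j
  ... | inj₁ i↦j = i↦j
  ... | inj₂ j↦i = ⊥-elim (ℕ.<-asym i<j (Edge⇒< j↦i))

  Edge⇒∈-edgesOf : ∀ {i j} → Edge (toℕ i) (toℕ j) → (i , j) ∈ edgesOf (spider λs)
  Edge⇒∈-edgesOf i↦j = ∈-edgesOf⁺ (Edge⇒< i↦j) (spider-adj⁺ i↦j)

  child : Fin (length (edgesOf (spider λs))) → ℕ
  child e = toℕ (proj₂ (lookup (edgesOf (spider λs)) e))

  Edge-lookup : ∀ e → Edge (toℕ (proj₁ (lookup (edgesOf (spider λs)) e))) (child e)
  Edge-lookup e = ∈-edgesOf⇒Edge (∈-lookup {xs = edgesOf (spider λs)} e)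

  child-bounds : ∀ e → 1 ≤ child e × child e ≤ N
  child-bounds e = Edge-bounds (Edge-lookup e)

  incident⇒Endpoint : ∀ {v} e → Incident v (child e) → Endpoint v e
  incident⇒Endpoint e (inj₁ v≡parent) = inj₁ (trans v≡parent (Edge⇒parent (Edge-lookup e)))
  incident⇒Endpoint e (inj₂ v≡child)  = inj₂ v≡child

  child-injective : ∀ {e f} → child e ≡ child f → e ≡ f
  child-injective {e} {f} children≡ = lookup-injective edgesOf-unique
    (cong₂ _,_ (toℕ-injective parents≡) (toℕ-injective children≡))
    where
    parents≡ = trans (sym (Edge⇒parent (Edge-lookup e)))
                     (trans (cong parent children≡) (Edge⇒parent (Edge-lookup f)))

  edgeWithChild∈ : ∀ {k} (1≤k : 1 ≤ k) (k≤N : k ≤ N) →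
    (fromℕ< (s≤s (ℕ.≤-trans (ℕ.<⇒≤ (parent< 1≤k k≤N)) k≤N)) , fromℕ< (s≤s k≤N)) ∈ edgesOf (spider λs)
  edgeWithChild∈ 1≤k k≤N =
    Edge⇒∈-edgesOf (subst₂ Edge (sym (toℕ-fromℕ< _)) (sym (toℕ-fromℕ< _)) (Edge-parent 1≤k k≤N))

  edgeWithChild : ∀ {k} → 1 ≤ k → k ≤ N → Fin (length (edgesOf (spider λs)))
  edgeWithChild 1≤k k≤N = index (edgeWithChild∈ 1≤k k≤N)

  child-edgeWithChild : ∀ {k} (1≤k : 1 ≤ k) (k≤N : k ≤ N) → child (edgeWithChild 1≤k k≤N) ≡ k
  child-edgeWithChild 1≤k k≤N =
    trans (cong (toℕ ∘ proj₂) (sym (lookup-index (edgeWithChild∈ 1≤k k≤N)))) (toℕ-fromℕ< _)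

  spider─vertex⇒lineGraph : ∀ x → BijectiveHomomorphism (spider λs ─ x) (lineGraph (spider λs))
  spider─vertex⇒lineGraph x = record
    { bijection = permutation σ σ⁻¹ σ∘σ⁻¹ σ⁻¹∘σ ; preserves-adj = σ-preserves-adj }
    where
    open Towards (toℕ x) (s≤s⁻¹ (toℕ<n x))

    vertex : Fin N → ℕ
    vertex j = toℕ (punchIn x j)

    vertex≢x : ∀ j → vertex j ≢ toℕ x
    vertex≢x j = punchInᵢ≢i x j ∘ toℕ-injective

    σ : Fin N → Fin (length (edgesOf (spider λs)))
    σ j = let (1≤k , k≤N) = towards-bounds (s≤s⁻¹ (toℕ<n (punchIn x j))) (vertex≢x j)
          in edgeWithChild 1≤k k≤N

    child-σ : ∀ j → child (σ j) ≡ towards (vertex j)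
    child-σ j = child-edgeWithChild _ _

    source-bounds : ∀ e → towards⁻¹ (child e) ≤ N × towards⁻¹ (child e) ≢ toℕ x
    source-bounds e = towards⁻¹-bounds (proj₁ (child-bounds e)) (proj₂ (child-bounds e))

    source : Fin (length (edgesOf (spider λs))) → Fin (suc N)
    source e = fromℕ< (s≤s (proj₁ (source-bounds e)))

    toℕ-source : ∀ e → toℕ (source e) ≡ towards⁻¹ (child e)
    toℕ-source e = toℕ-fromℕ< (s≤s (proj₁ (source-bounds e)))

    x≢source : ∀ e → x ≢ source e
    x≢source e x≡ = proj₂ (source-bounds e) (trans (sym (toℕ-source e)) (cong toℕ (sym x≡)))

    σ⁻¹ : Fin (length (edgesOf (spider λs))) → Fin N
    σ⁻¹ e = punchOut (x≢source e)

    σ∘σ⁻¹ : ∀ e → σ (σ⁻¹ e) ≡ e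
    σ∘σ⁻¹ e = child-injective (begin
      child (σ (σ⁻¹ e))                     ≡⟨ child-σ (σ⁻¹ e) ⟩
      towards (toℕ (punchIn x (σ⁻¹ e)))      ≡⟨ cong (towards ∘ toℕ) (punchIn-punchOut (x≢source e)) ⟩
      towards (toℕ (source e))              ≡⟨ cong towards (toℕ-source e) ⟩
      towards (towards⁻¹ (child e))         ≡⟨ uncurry towards-towards⁻¹ (child-bounds e) ⟩
      child e                               ∎)
      where open ≡-Reasoning

    σ⁻¹∘σ : ∀ j → σ⁻¹ (σ j) ≡ j
    σ⁻¹∘σ j = trans (punchOut-cong x source-σ) (punchOut-punchIn x)
      where
      source-σ : source (σ j) ≡ punchIn x j
      source-σ = toℕ-injective (trans (toℕ-source (σ j))
        (trans (cong towards⁻¹ (child-σ j)) (towards⁻¹-towards (vertex≢x j))))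

    σ-preserves-adj : ∀ {i j} → adj (spider λs) (punchIn x i) (punchIn x j) ≡ true →
      adj (lineGraph (spider λs)) (σ i) (σ j) ≡ true
    σ-preserves-adj {i} {j} i~j =
      let (distinct , v , v∈i , v∈j) = towards-adjacent (spider-adj⁻ i~j) (vertex≢x i) (vertex≢x j) in
      lineGraph-adj {σ i} {σ j} v
        (λ eq → distinct (trans (sym (child-σ i)) (trans (cong child (toℕ-injective eq)) (child-σ j))))
        (incident⇒Endpoint (σ i) (subst (Incident v) (sym (child-σ i)) v∈i))
        (incident⇒Endpoint (σ j) (subst (Incident v) (sym (child-σ j)) v∈j))

open SpiderLineGraph using (spider─vertex⇒lineGraph)

lineGraph-spider-order : ∀ λs → n (lineGraph (spider λs)) ≡ sum λs
lineGraph-spider-order λs =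
  sym (↔⇒≡ (BijectiveHomomorphism.bijection (spider─vertex⇒lineGraph λs zero)))

proposition6p8 : (λs : List ℕ) → All NonZero λs →
    HasConnectedPartitionOfEveryType (spider λs) →
    HasConnectedPartitionOfEveryType (lineGraph (spider λs))
proposition6p8 λs _ every μ μ-partition =
  let μ-partition′ = subst (λ m → IsPartition m μ) (lineGraph-spider-order λs) μ-partition
      μ∷ʳ1-partition = IsPartition-∷ʳ-1 μ-partition′
      (x , partition─x) = deleteSingletonBlock (spider λs) μ (every (μ ∷ʳ 1) μ∷ʳ1-partition)
  in transportConnectedPartition {μ = μ} (spider─vertex⇒lineGraph λs x) partition─x
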